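{- For every fixed real $\varepsilon>0$ there exists an integer $N$ depending only on $\varepsilon$ such that for all integers $k \geq N$ there exists a $(k-1,k)$-comprehensive tournament of order $\lceil (\ln 2+\varepsilon)k^2 2^k\rceil$.
   Context: For a tournament $T$ with vertices ordered in some fixed way, a vertex $z$ and a set $A=\{u_1,\dots,u_{|A|}\}$ of neighbours of $z$ (in that order), $F(A,z,T)\in\{ -1,1\}^{|A|}$ has $i$-th entry $1$ if $(z,u_i)$ is an arc and $-1$ if $(u_i,z)$ is an arc. A tournament $T$ is $(k,t)$-comprehensive if for every $U\subseteq V(T)$ with $|U|=k$ and every $\vec a\in\{ -1,1\}^k$ there exist at least $t$ vertices $z\in V(T)\setminus U$ with $F(U,z,T)=\vec a$. -}

module Defs where

open import Data.Nat as ℕ using (ℕ; zero; suc)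
open import Data.Integer using (ℤ; +_)
open import Data.Rational using (ℚ; _/_; _+_; _*_; _-_; ∣_∣; _≤_; _<_; 0ℚ; 1ℚ; ½)
open import Data.Fin using (Fin)
open import Data.Bool using (Bool; true; false; not)
open import Data.Product using (Σ; ∃; _×_)
open import Function.Definitions using (Injective)
open import Relation.Binary.PropositionalEquality using (_≡_; _≢_)

inv : ℕ → ℚ
inv m = + 1 / suc m

ℕ→ℚ : ℕ → ℚ
ℕ→ℚ n = + n / 1

-- A real number x is given by rationals x_m with |x_m - x_n| ≤ 1/(m+1) + 1/(n+1);
-- its value is the limit, and |x_m - x| ≤ 1/(m+1).
record ℝ : Set where
  field
    seq : ℕ → ℚ
    reg : ∀ m n → ∣ seq m - seq n ∣ ≤ inv m + inv n
open ℝ public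

-- x > 0 (Bishop): some approximation exceeds its error bound
Positive : ℝ → Set
Positive x = ∃ λ m → inv m < seq x m

halfPow : ℕ → ℚ
halfPow zero = 1ℚ
halfPow (suc i) = ½ * halfPow i

-- partial sums of ln 2 = Σ_{i ≥ 1} 1 / (i 2^i);  |ln2Sum m - ln 2| ≤ 1/((m+1) 2^m) ≤ 1/(m+1)
ln2Sum : ℕ → ℚ
ln2Sum zero = 0ℚ
ln2Sum (suc m) = ln2Sum m + inv m * halfPow (suc m)

-- Approximations of the real number  M · (ln 2 + ε)  :
--   approx m = M (ln2Sum m + ε_m)   with   |approx m - M (ln 2 + ε)| ≤ err m = M (2/(m+1)),
-- and err m → 0.
approxLn2ε : ℝ → ℕ → ℕ → ℚ
approxLn2ε ε M m = ℕ→ℚ M * (ln2Sum m + seq ε m)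

errLn2ε : ℕ → ℕ → ℚ
errLn2ε M m = ℕ→ℚ M * (inv m + inv m)

_<M[ln2+_]·_ : ℚ → ℝ → ℕ → Set
q <M[ln2+ ε ]· M = ∃ λ m → q + errLn2ε M m < approxLn2ε ε M m

M[ln2+_]·_≤_ : ℝ → ℕ → ℚ → Set
M[ln2+ ε ]· M ≤ q = ∀ m → approxLn2ε ε M m ≤ q + errLn2ε M m

IsCeilMulLn2ε : ℝ → ℕ → ℕ → Set
IsCeilMulLn2ε ε M n = ((ℕ→ℚ n - 1ℚ) <M[ln2+ ε ]· M) × (M[ln2+ ε ]· M ≤ ℕ→ℚ n)

record Tournament (n : ℕ) : Set where
  field
    arc    : Fin n → Fin n → Bool
    irrefl : ∀ u → arc u u ≡ false
    tourn  : ∀ u v → u ≢ v → arc u v ≡ not (arc v u)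
open Tournament public

-- strictly increasing enumeration u_1 < … < u_k of a k-subset U
Increasing : ∀ {k n} → (Fin k → Fin n) → Set
Increasing {k} u = ∀ (i j : Fin k) → i Data.Fin.< j → u i Data.Fin.< u j

-- F(U,z,T) = a, with a : Fin k → Bool encoding {-1,1}^k (true = 1, i.e. (z,u_i) is an arc)
FEq : ∀ {k n} → Tournament n → (Fin k → Fin n) → Fin n → (Fin k → Bool) → Set
FEq T u z a = ∀ i → arc T z (u i) ≡ a i

Comprehensive : ∀ {n} → Tournament n → ℕ → ℕ → Set
Comprehensive {n} T k t =
  (u : Fin k → Fin n) → Increasing u → (a : Fin k → Bool) →
  Σ (Fin t → Fin n) λ w → Injective _≡_ _≡_ w ×
    (∀ j → (∀ i → w j ≢ u i) × FEq T u (w j) a)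

-- Derandomised probabilistic method.  Every vertex z carries a row x_z ∈ {0,1}^n, and the edge uv
-- is oriented by x_u(v) ⊕ x_v(u) ⊕ [u < v].  Fix a (k−1)-set U and a sign vector a.  With all other
-- rows fixed, a vertex z ∉ U has the prescribed adjacency to U for 2^(n−k+1) of the 2^n values of
-- x_z, and this event does not depend on the rows of the other vertices outside U.  Resampling one
-- row at a time then bounds the number of configurations in which at most k−1 vertices succeed by a
-- weighted lower binomial tail, and Chernoff's bound (with weight 8) makes the sum of these counts
-- over all (U, a) smaller than the number (2^n)^n of configurations once k ≥ 200 and
-- n ≥ (3/5) k² 2^k; the ceiling hypothesis gives the latter because ln 2 > 3/5.

module Submission where

module CeilingBound where

  open import Data.Integer as ℤ using (+_)
  import Data.Integer.Properties as ℤ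
  open import Data.Rational
    using (ℚ; mkℚ; _/_; _+_; _*_; _-_; -_; ∣_∣; _≤_; _<_; 0ℚ; _≤?_; toℚᵘ; nonNegative)
  open import Data.Rational.Properties
  import Data.Rational.Unnormalised as ℚᵘ
  import Data.Rational.Unnormalised.Properties as ℚᵘ
  open import Data.Rational.Solver using (module +-*-Solver)
  open +-*-Solver using (solve; _:+_; _:*_; _:-_; :-_; _:=_)
  import Data.Nat.Coprimality as Coprime
  open import Data.Sum using (inj₁; inj₂)
  open import Data.Product using (_,_)
  open import Relation.Nullary.Decidable using (toWitness)
  open import Relation.Binary.PropositionalEquality
  import Data.Nat as ℕ
  import Data.Nat.Properties as ℕₚ
  open import Defs using (ℝ; Positive; seq; reg; inv; ℕ→ℚ; ln2Sum; M[ln2+_]·_≤_)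

  0≤-⇐≤ : ∀ {p q} → p ≤ q → 0ℚ ≤ q - p
  0≤-⇐≤ {p} {q} p≤q = subst (_≤ q - p) (+-inverseʳ p) (+-monoˡ-≤ (- p) p≤q)

  0≤-⇒≤ : ∀ {p q} → 0ℚ ≤ q - p → p ≤ q
  0≤-⇒≤ {p} {q} 0≤q-p = subst₂ _≤_ (+-identityˡ p) (cancel q p) (+-monoˡ-≤ p 0≤q-p)
    where
    cancel : ∀ q p → (q - p) + p ≡ q
    cancel = solve 2 (λ q p → (q :- p) :+ p := q) refl

  0<-⇐< : ∀ {p q} → p < q → 0ℚ < q - p
  0<-⇐< {p} {q} p<q = subst (_< q - p) (+-inverseʳ p) (+-monoˡ-< (- p) p<q)

  0≤+ : ∀ {p q} → 0ℚ ≤ p → 0ℚ ≤ q → 0ℚ ≤ p + q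
  0≤+ {p} {q} 0≤p 0≤q = subst (_≤ p + q) (+-identityʳ 0ℚ) (+-mono-≤ 0≤p 0≤q)

  0<+ : ∀ {p q} → 0ℚ < p → 0ℚ ≤ q → 0ℚ < p + q
  0<+ {p} {q} 0<p 0≤q = subst (_< p + q) (+-identityʳ 0ℚ) (+-mono-<-≤ 0<p 0≤q)

  0≤* : ∀ {p q} → 0ℚ ≤ p → 0ℚ ≤ q → 0ℚ ≤ p * q
  0≤* {p} {q} 0≤p 0≤q = subst (_≤ p * q) (*-zeroʳ p) (*-monoˡ-≤-nonNeg p {{nonNegative 0≤p}} 0≤q)

  p≤∣p∣ : ∀ p → p ≤ ∣ p ∣
  p≤∣p∣ p with ∣p∣≡p∨∣p∣≡-p p
  ... | inj₁ ∣p∣≡p  = ≤-reflexive (sym ∣p∣≡p)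
  ... | inj₂ ∣p∣≡-p = ≤-trans p≤0 (0≤∣p∣ p)
    where
    p≤0 : p ≤ 0ℚ
    p≤0 = subst (_≤ 0ℚ) (neg-involutive p) (neg-antimono-≤ (subst (0ℚ ≤_) ∣p∣≡-p (0≤∣p∣ p)))
      where
      neg-involutive : ∀ p → - (- p) ≡ p
      neg-involutive = solve 1 (λ p → :- (:- p) := p) refl

  ℕ→ℚ-normal : ℕ.ℕ → ℚ
  ℕ→ℚ-normal a = mkℚ (+ a) 0 (Coprime.sym (Coprime.1-coprimeTo a))

  ℕ→ℚ≡ℕ→ℚ-normal : ∀ a → ℕ→ℚ a ≡ ℕ→ℚ-normal a
  ℕ→ℚ≡ℕ→ℚ-normal a = normalize-coprime (Coprime.sym (Coprime.1-coprimeTo a))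

  0≤ℕ→ℚ : ∀ a → 0ℚ ≤ ℕ→ℚ a
  0≤ℕ→ℚ a = subst (0ℚ ≤_) (sym (ℕ→ℚ≡ℕ→ℚ-normal a)) (nonNegative⁻¹ _)

  ℕ→ℚ-*-≤-reflect : ∀ a b c d → ℕ→ℚ a * ℕ→ℚ c ≤ ℕ→ℚ b * ℕ→ℚ d → a ℕ.* c ℕ.≤ b ℕ.* d
  ℕ→ℚ-*-≤-reflect a b c d ac≤bd
    rewrite ℕ→ℚ≡ℕ→ℚ-normal a | ℕ→ℚ≡ℕ→ℚ-normal b | ℕ→ℚ≡ℕ→ℚ-normal c | ℕ→ℚ≡ℕ→ℚ-normal d =
    ℤ.drop‿+≤+ (subst₂ ℤ._≤_ (unit a c) (unit b d) (ℚᵘ.drop-*≤* unnormalised))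
    where
    unnormalised : toℚᵘ (ℕ→ℚ-normal a) ℚᵘ.* toℚᵘ (ℕ→ℚ-normal c) ℚᵘ.≤ toℚᵘ (ℕ→ℚ-normal b) ℚᵘ.* toℚᵘ (ℕ→ℚ-normal d)
    unnormalised = ℚᵘ.≤-respʳ-≃ (toℚᵘ-homo-* (ℕ→ℚ-normal b) (ℕ→ℚ-normal d))
                     (ℚᵘ.≤-respˡ-≃ (toℚᵘ-homo-* (ℕ→ℚ-normal a) (ℕ→ℚ-normal c)) (toℚᵘ-mono-≤ ac≤bd))
    unit : ∀ a c → (+ a ℤ.* + c) ℤ.* + 1 ≡ + (a ℕ.* c)
    unit a c = trans (ℤ.*-identityʳ _) (sym (ℤ.pos-* a c))

  Positive⇒0≤seq+inv : ∀ (ε : ℝ) → Positive ε → ∀ m → 0ℚ ≤ seq ε m + inv m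
  Positive⇒0≤seq+inv ε (m₀ , j<y) m =
    <⇒≤ (subst (0ℚ <_) (collect x y i j a) (0<+ (0<-⇐< j<y) (0≤+ a≤i+j y-x≤a)))
    where
    x = seq ε m
    y = seq ε m₀
    i = inv m
    j = inv m₀
    a = ∣ x - y ∣
    a≤i+j : 0ℚ ≤ (i + j) - a
    a≤i+j = 0≤-⇐≤ (reg ε m m₀)
    y-x≤a : 0ℚ ≤ a - (y - x)
    y-x≤a = 0≤-⇐≤ (subst₂ _≤_ (sym (negate x y)) (∣-p∣≡∣p∣ (x - y)) (p≤∣p∣ (- (x - y))))
      where
      negate : ∀ x y → y - x ≡ - (x - y)
      negate = solve 2 (λ x y → y :- x := :- (x :- y)) refl
    collect : ∀ x y i j a → (y - j) + (((i + j) - a) + (a - (y - x))) ≡ x + i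
    collect = solve 5 (λ x y i j a → (y :- j) :+ (((i :+ j) :- a) :+ (a :- (y :- x))) := x :+ i) refl

  ceiling⇒3M≤5n : ∀ (ε : ℝ) → Positive ε → ∀ M n → M[ln2+ ε ]· M ≤ ℕ→ℚ n → 3 ℕ.* M ℕ.≤ 5 ℕ.* n
  ceiling⇒3M≤5n ε ε>0 M n ceiling =
    subst₂ ℕ._≤_ (ℕₚ.*-comm M 3) (ℕₚ.*-comm n 5) (ℕ→ℚ-*-≤-reflect M n 3 5
      (subst (_≤ n′ * ℕ→ℚ 5) (reassoc M′ c (ℕ→ℚ 5)) (*-monoʳ-≤-nonNeg (ℕ→ℚ 5) {M′ * c} {n′} Mc≤n)))
    where
    x = seq ε 33
    i = inv 33
    L = ln2Sum 33
    M′ = ℕ→ℚ M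
    n′ = ℕ→ℚ n
    c = + 3 / 5
    -- 3/5 ≤ ln2Sum 33 − 3/34: this is where 3/5 < ln 2 enters, net of the approximation errors.
    ln2-slack : 0ℚ ≤ (L - (i + i + i)) - c
    ln2-slack = toWitness {a? = 0ℚ ≤? ((ln2Sum 33 - (inv 33 + inv 33 + inv 33)) - (+ 3 / 5))} _
    collect : ∀ n′ M′ i L x c →
      ((n′ + M′ * (i + i)) - M′ * (L + x)) + M′ * ((x + i) + ((L - (i + i + i)) - c)) ≡ n′ - M′ * c
    collect = solve 6 (λ n′ M′ i L x c →
      ((n′ :+ M′ :* (i :+ i)) :- M′ :* (L :+ x)) :+ M′ :* ((x :+ i) :+ ((L :- (i :+ i :+ i)) :- c))
        := n′ :- M′ :* c) refl
    Mc≤n : M′ * c ≤ n′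
    Mc≤n = 0≤-⇒≤ (subst (0ℚ ≤_) (collect n′ M′ i L x c)
      (0≤+ (0≤-⇐≤ (ceiling 33)) (0≤* (0≤ℕ→ℚ M) (0≤+ (Positive⇒0≤seq+inv ε ε>0 33) ln2-slack))))
    reassoc : ∀ M′ c f → M′ * c * f ≡ M′ * (c * f)
    reassoc = solve 3 (λ M′ c f → M′ :* c :* f := M′ :* (c :* f)) refl

open import Data.Nat using (ℕ; zero; suc; _+_; _*_; _^_; _∸_; _≤_; _<_; z≤n; s≤s; s≤s⁻¹; NonZero; >-nonZero; _/_; _%_)
open import Data.Nat.DivMod using (m≡m%n+[m/n]*n; m%n<n)
open import Data.Nat.Properties
open import Data.Fin using (Fin; zero; suc)
import Data.Fin.Properties as Fin
open import Data.Vec using (Vec; []; _∷_; lookup; _[_]≔_; replicate; tabulate)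
open import Data.Vec.Properties using (lookup∘update; lookup∘update′; lookup∘tabulate)
open import Data.Bool using (Bool; true; false; not; if_then_else_; _xor_; _∧_)
open import Data.Bool.Properties as Bool using (xor-same; xor-comm; not-distribʳ-xor)
open import Data.Maybe using (Maybe; just; nothing; is-nothing)
open import Relation.Binary.Definitions using (tri<; tri≈; tri>)
open import Defs using (ℝ; Positive; IsCeilMulLn2ε; Tournament; FEq; Increasing; Comprehensive)
open import Data.Product using (∃; Σ; _,_; proj₁; proj₂; _×_; map₂)
open import Function using (_∘_)
open import Function.Definitions using (Injective)
open import Function.Bundles using (_⇔_; mk⇔; Equivalence)
import Function.Properties.Equivalence as ⇔
open import Relation.Binary.PropositionalEquality
open import Relation.Nullary using (Dec; yes; no; does; ¬_; contradiction)
open import Data.Empty using (⊥-elim)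
open import Relation.Nullary.Decidable using (dec-true; dec-false; does-⇔; ¬?; _×-dec_; _→-dec_; map′; from-yes)
open import Data.Nat.Tactic.RingSolver using (solve-∀)
open import Algebra.Properties.CommutativeSemigroup +-commutativeSemigroup
  using () renaming (interchange to +-interchange)

record Summation (A : Set) : Set where
  field
    ∑        : (A → ℕ) → ℕ
    ∑-+      : ∀ f g → ∑ (λ x → f x + g x) ≡ ∑ f + ∑ g
    ∑-mono-≤ : ∀ {f g} → (∀ x → f x ≤ g x) → ∑ f ≤ ∑ g
    ≤-∑      : ∀ f x → f x ≤ ∑ f
    ∑<∑⇒∃<   : ∀ f g → ∑ f < ∑ g → ∃ λ x → f x < g x
    card     : ℕ
    ∑-1      : ∑ (λ _ → 1) ≡ card

  ∑-cong : ∀ {f g} → (∀ x → f x ≡ g x) → ∑ f ≡ ∑ g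
  ∑-cong f≗g = ≤-antisym (∑-mono-≤ (λ x → ≤-reflexive (f≗g x)))
                         (∑-mono-≤ (λ x → ≤-reflexive (sym (f≗g x))))

  ∑-0 : ∑ (λ _ → 0) ≡ 0
  ∑-0 = sym (+-cancelˡ-≡ (∑ (λ _ → 0)) _ _
          (trans (+-identityʳ _) (∑-+ (λ _ → 0) (λ _ → 0))))

  ∑-*ˡ : ∀ c f → ∑ (λ x → c * f x) ≡ c * ∑ f
  ∑-*ˡ zero    f = ∑-0
  ∑-*ˡ (suc c) f = trans (∑-+ f (λ x → c * f x)) (cong (∑ f +_) (∑-*ˡ c f))

  ∑-linear : ∀ c d f g → ∑ (λ x → c * f x + d * g x) ≡ c * ∑ f + d * ∑ g
  ∑-linear c d f g = trans (∑-+ _ _) (cong₂ _+_ (∑-*ˡ c f) (∑-*ˡ d g))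

  ∑-const : ∀ c → ∑ (λ _ → c) ≡ card * c
  ∑-const c = begin
    ∑ (λ _ → c)      ≡⟨ ∑-cong (λ _ → sym (*-identityʳ c)) ⟩
    ∑ (λ _ → c * 1)  ≡⟨ ∑-*ˡ c (λ _ → 1) ⟩
    c * ∑ (λ _ → 1)  ≡⟨ cong (c *_) ∑-1 ⟩
    c * card         ≡⟨ *-comm c card ⟩
    card * c         ∎
    where open ≡-Reasoning

open Summation public

Fubini : ∀ {A} → Summation A → Set₁
Fubini {A} SA = ∀ {B} (SB : Summation B) (f : A → B → ℕ) →
  ∑ SA (λ x → ∑ SB (f x)) ≡ ∑ SB (λ y → ∑ SA (λ x → f x y))

sumBool : Summation Bool
sumBool = record
  { ∑        = λ f → f true + f false
  ; ∑-+      = λ f g → +-interchange (f true) (g true) (f false) (g false)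
  ; ∑-mono-≤ = λ f≤g → +-mono-≤ (f≤g true) (f≤g false)
  ; ≤-∑      = λ { f true → m≤m+n _ _ ; f false → m≤n+m _ _ }
  ; ∑<∑⇒∃<   = witness
  ; card     = 2
  ; ∑-1      = refl
  }
  where
  witness : ∀ f g → f true + f false < g true + g false → ∃ λ x → f x < g x
  witness f g lt with f true <? g true
  ... | yes ft<gt = true , ft<gt
  ... | no ft≮gt = false , +-cancelˡ-< (f true) _ _
                     (<-≤-trans lt (+-monoˡ-≤ (g false) (≮⇒≥ ft≮gt)))

sumBool-fubini : Fubini sumBool
sumBool-fubini SB f = sym (∑-+ SB (f true) (f false))

∑Fin : ∀ n → (Fin n → ℕ) → ℕ
∑Fin zero    f = 0
∑Fin (suc n) f = f zero + ∑Fin n (λ i → f (suc i))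

private
  ∑Fin-+ : ∀ n f g → ∑Fin n (λ x → f x + g x) ≡ ∑Fin n f + ∑Fin n g
  ∑Fin-+ zero    f g = refl
  ∑Fin-+ (suc n) f g = trans (cong (f zero + g zero +_) (∑Fin-+ n _ _))
                             (+-interchange (f zero) (g zero) _ _)

  ∑Fin-mono-≤ : ∀ n {f g : Fin n → ℕ} → (∀ x → f x ≤ g x) → ∑Fin n f ≤ ∑Fin n g
  ∑Fin-mono-≤ zero    f≤g = z≤n
  ∑Fin-mono-≤ (suc n) f≤g = +-mono-≤ (f≤g zero) (∑Fin-mono-≤ n (λ i → f≤g (suc i)))

  ≤-∑Fin : ∀ n f x → f x ≤ ∑Fin n f
  ≤-∑Fin (suc n) f zero    = m≤m+n _ _
  ≤-∑Fin (suc n) f (suc x) = ≤-trans (≤-∑Fin n _ x) (m≤n+m _ _)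

  ∑Fin<⇒∃< : ∀ n f g → ∑Fin n f < ∑Fin n g → ∃ λ x → f x < g x
  ∑Fin<⇒∃< (suc n) f g lt with f zero <? g zero
  ... | yes f0<g0 = zero , f0<g0
  ... | no f0≮g0 with ∑Fin<⇒∃< n (λ i → f (suc i)) (λ i → g (suc i))
                        (+-cancelˡ-< (f zero) _ _ (<-≤-trans lt (+-monoˡ-≤ _ (≮⇒≥ f0≮g0))))
  ...   | x , fx<gx = suc x , fx<gx

  ∑Fin-1 : ∀ n → ∑Fin n (λ _ → 1) ≡ n
  ∑Fin-1 zero    = refl
  ∑Fin-1 (suc n) = cong suc (∑Fin-1 n)

sumFin : ∀ n → Summation (Fin n)
sumFin n = record
  { ∑ = ∑Fin n ; ∑-+ = ∑Fin-+ n ; ∑-mono-≤ = ∑Fin-mono-≤ n ; ≤-∑ = ≤-∑Fin n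
  ; ∑<∑⇒∃< = ∑Fin<⇒∃< n ; card = n ; ∑-1 = ∑Fin-1 n }

sumFin-fubini : ∀ n → Fubini (sumFin n)
sumFin-fubini zero    SB f = sym (∑-0 SB)
sumFin-fubini (suc n) SB f = trans (cong (∑ SB (f zero) +_) (sumFin-fubini n SB (λ i → f (suc i))))
                                   (sym (∑-+ SB _ _))

module _ {A : Set} (SA : Summation A) where
  ∑Vec : ∀ n → (Vec A n → ℕ) → ℕ
  ∑Vec zero    f = f []
  ∑Vec (suc n) f = ∑ SA (λ x → ∑Vec n (λ v → f (x ∷ v)))

  private
    ∑Vec-+ : ∀ n f g → ∑Vec n (λ x → f x + g x) ≡ ∑Vec n f + ∑Vec n g
    ∑Vec-+ zero    f g = refl
    ∑Vec-+ (suc n) f g = trans (∑-cong SA (λ x → ∑Vec-+ n _ _)) (∑-+ SA _ _)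

    ∑Vec-mono-≤ : ∀ n {f g : Vec A n → ℕ} → (∀ x → f x ≤ g x) → ∑Vec n f ≤ ∑Vec n g
    ∑Vec-mono-≤ zero    f≤g = f≤g []
    ∑Vec-mono-≤ (suc n) f≤g = ∑-mono-≤ SA (λ x → ∑Vec-mono-≤ n (λ v → f≤g (x ∷ v)))

    ≤-∑Vec : ∀ n f v → f v ≤ ∑Vec n f
    ≤-∑Vec zero    f []      = ≤-refl
    ≤-∑Vec (suc n) f (x ∷ v) = ≤-trans (≤-∑Vec n _ v) (≤-∑ SA (λ x → ∑Vec n (λ v → f (x ∷ v))) x)

    ∑Vec<⇒∃< : ∀ n f g → ∑Vec n f < ∑Vec n g → ∃ λ v → f v < g v
    ∑Vec<⇒∃< zero    f g lt = [] , lt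
    ∑Vec<⇒∃< (suc n) f g lt with ∑<∑⇒∃< SA _ _ lt
    ... | x , ltₓ with ∑Vec<⇒∃< n _ _ ltₓ
    ...   | v , ltᵥ = x ∷ v , ltᵥ

    ∑Vec-1 : ∀ n → ∑Vec n (λ _ → 1) ≡ card SA ^ n
    ∑Vec-1 zero    = refl
    ∑Vec-1 (suc n) = trans (∑-cong SA (λ _ → ∑Vec-1 n)) (∑-const SA (card SA ^ n))

  sumVec : ∀ n → Summation (Vec A n)
  sumVec n = record
    { ∑ = ∑Vec n ; ∑-+ = ∑Vec-+ n ; ∑-mono-≤ = ∑Vec-mono-≤ n ; ≤-∑ = ≤-∑Vec n
    ; ∑<∑⇒∃< = ∑Vec<⇒∃< n ; card = card SA ^ n ; ∑-1 = ∑Vec-1 n }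

  sumVec-fubini : Fubini SA → ∀ n → Fubini (sumVec n)
  sumVec-fubini fubini zero    SB f = refl
  sumVec-fubini fubini (suc n) SB f =
    trans (∑-cong SA (λ x → sumVec-fubini fubini n SB (λ v → f (x ∷ v)))) (fubini SB _)

indicator : Bool → ℕ
indicator true  = 1
indicator false = 0

count : ∀ {n} → (Fin n → Bool) → ℕ
count {n} p = ∑Fin n (indicator ∘ p)

count+count-not : ∀ {n} (p : Fin n → Bool) → count p + count (not ∘ p) ≡ n
count+count-not {zero}  p = refl
count+count-not {suc n} p with p zero
... | true  = cong suc (count+count-not (p ∘ suc))
... | false = trans (+-suc _ _) (cong suc (count+count-not (p ∘ suc)))

indicator≡0 : ∀ {e} → indicator e ≡ 0 → e ≡ false
indicator≡0 {false} _ = refl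

indicator-≤ : ∀ {e f} → (e ≡ true → f ≡ true) → indicator e ≤ indicator f
indicator-≤ {true}  e⇒f rewrite e⇒f refl = ≤-refl
indicator-≤ {false} e⇒f = z≤n

from-does-true : ∀ {A : Set} (a? : Dec A) → does a? ≡ true → A
from-does-true (yes a) _ = a

from-does-false : ∀ {A : Set} (a? : Dec A) → does a? ≡ false → ¬ A
from-does-false (no ¬a) _ = ¬a

indicator-does-≤ : ∀ {P Q : Set} (P? : Dec P) (Q? : Dec Q) → (P → Q) →
  indicator (does P?) ≤ indicator (does Q?)
indicator-does-≤ P? Q? P⇒Q = indicator-≤ (dec-true Q? ∘ P⇒Q ∘ from-does-true P?)

atMost : ℕ → ℕ → ℕ
atMost j c = indicator (does (c ≤? j))

atMost-suc : ∀ j c → atMost (suc j) (suc c) ≡ atMost j c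
atMost-suc j c = cong indicator (does-⇔ (mk⇔ s≤s⁻¹ s≤s) (suc c ≤? suc j) (c ≤? j))

atMost-zero : ∀ c → atMost 0 (suc c) ≡ 0
atMost-zero c = cong indicator (dec-false (suc c ≤? 0) λ ())

atMost-antitone : ∀ j c → atMost j (suc c) ≤ atMost j c
atMost-antitone j c = indicator-does-≤ (suc c ≤? j) (c ≤? j) <⇒≤

atMost≡0⇒< : ∀ j c → atMost j c ≡ 0 → j < c
atMost≡0⇒< j c h = ≰⇒> (from-does-false (c ≤? j) (indicator≡0 h))

rebalance-≤ : ∀ {A B s s′ a R} → s + s′ ≡ R → a ≤ s → A ≤ B →
  A * s + B * s′ ≤ a * A + (R ∸ a) * B
rebalance-≤ {A} {B} {s} {s′} {a} {R} s+s′≡R a≤s A≤B = begin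
  A * s + B * s′              ≡⟨ cong (λ t → A * t + B * s′) (sym (m+[n∸m]≡n a≤s)) ⟩
  A * (a + d) + B * s′        ≡⟨ split A B a d s′ ⟩
  A * a + (A * d + B * s′)    ≤⟨ +-monoʳ-≤ (A * a) (+-monoˡ-≤ (B * s′) (*-monoˡ-≤ d A≤B)) ⟩
  A * a + (B * d + B * s′)    ≡⟨ cong (A * a +_) (sym (*-distribˡ-+ B d s′)) ⟩
  A * a + B * (d + s′)        ≡⟨ cong (λ t → A * a + B * t) d+s′≡R∸a ⟩
  A * a + B * (R ∸ a)         ≡⟨ cong₂ _+_ (*-comm A a) (*-comm B (R ∸ a)) ⟩
  a * A + (R ∸ a) * B         ∎
  where
  open ≤-Reasoning
  d = s ∸ a
  split : ∀ A B a d s′ → A * (a + d) + B * s′ ≡ A * a + (A * d + B * s′)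
  split = solve-∀
  d+s′≡R∸a : d + s′ ≡ R ∸ a
  d+s′≡R∸a = trans (sym (+-∸-comm s′ a≤s)) (cong (_∸ a) s+s′≡R)

module LowerTail {X : Set} (SX : Summation X) (fubini : Fubini SX) (x₀ : X) (a : ℕ) where

  R : ℕ
  R = card SX

  b : ℕ
  b = R ∸ a

  -- lowerTail m j = Σ_{i ≤ j} C(m,i) a^i b^(m−i): outcomes of m trials, each succeeding in a of
  -- the R values, with at most j successes.
  lowerTail : ℕ → ℕ → ℕ
  lowerTail zero    j       = 1
  lowerTail (suc m) zero    = b * lowerTail m zero
  lowerTail (suc m) (suc j) = a * lowerTail m j + b * lowerTail m (suc j)

  ∑-if-≤ : ∀ (p : X → Bool) {A B} → A ≤ B → a ≤ ∑ SX (indicator ∘ p) →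
    ∑ SX (λ x → if p x then A else B) ≤ a * A + b * B
  ∑-if-≤ p {A} {B} A≤B a≤∑p = begin
    ∑ SX (λ x → if p x then A else B)
      ≡⟨ ∑-cong SX (λ x → if-as-sum (p x)) ⟩
    ∑ SX (λ x → A * indicator (p x) + B * indicator (not (p x)))
      ≡⟨ ∑-linear SX A B _ _ ⟩
    A * ∑ SX (indicator ∘ p) + B * ∑ SX (indicator ∘ not ∘ p)
      ≤⟨ rebalance-≤ partition a≤∑p A≤B ⟩
    a * A + b * B ∎
    where
    open ≤-Reasoning
    if-as-sum : ∀ e → (if e then A else B) ≡ A * indicator e + B * indicator (not e)
    if-as-sum true  = sym (trans (cong₂ _+_ (*-identityʳ A) (*-zeroʳ B)) (+-identityʳ A))
    if-as-sum false = sym (cong₂ _+_ (*-zeroʳ A) (*-identityʳ B))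
    indicator+indicator-not : ∀ e → indicator e + indicator (not e) ≡ 1
    indicator+indicator-not true  = refl
    indicator+indicator-not false = refl
    partition : ∑ SX (indicator ∘ p) + ∑ SX (indicator ∘ not ∘ p) ≡ R
    partition = trans (sym (∑-+ SX _ _))
                      (trans (∑-cong SX (indicator+indicator-not ∘ p)) (∑-1 SX))

  ∑-atMost-oneMore : ∀ {n} (e : Vec X n → X → Bool) (c : Vec X n → ℕ) →
    (∀ g → a ≤ ∑ SX (indicator ∘ e g)) → ∀ j →
    ∑ SX (λ x → ∑Vec SX n (λ g → atMost j (indicator (e g x) + c g)))
      ≤ a * ∑Vec SX n (λ g → atMost j (suc (c g))) + b * ∑Vec SX n (atMost j ∘ c)
  ∑-atMost-oneMore {n} e c hits j = begin
    ∑ SX (λ x → ∑Vec SX n (λ g → atMost j (indicator (e g x) + c g)))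
      ≡⟨ ∑-cong SX (λ x → ∑-cong (sumVec SX n) (λ g → split (e g x) (c g))) ⟩
    ∑ SX (λ x → ∑Vec SX n (λ g → if e g x then atMost j (suc (c g)) else atMost j (c g)))
      ≡⟨ fubini (sumVec SX n) _ ⟩
    ∑Vec SX n (λ g → ∑ SX (λ x → if e g x then atMost j (suc (c g)) else atMost j (c g)))
      ≤⟨ ∑-mono-≤ (sumVec SX n) (λ g → ∑-if-≤ (e g) (atMost-antitone j (c g)) (hits g)) ⟩
    ∑Vec SX n (λ g → a * atMost j (suc (c g)) + b * atMost j (c g))
      ≡⟨ ∑-linear (sumVec SX n) a b _ _ ⟩
    a * ∑Vec SX n (λ g → atMost j (suc (c g))) + b * ∑Vec SX n (atMost j ∘ c) ∎
    where
    open ≤-Reasoning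
    split : ∀ e c → atMost j (indicator e + c) ≡ (if e then atMost j (suc c) else atMost j c)
    split true  c = refl
    split false c = refl

  record LocallyIndependent {n} (frozen : Fin n → Bool) (E : Fin n → Vec X n → Bool) : Set where
    field
      frozen⇒false : ∀ z → frozen z ≡ true → ∀ g → E z g ≡ false
      resample-≥   : ∀ z → frozen z ≡ false → ∀ g → a ≤ ∑ SX (λ x → indicator (E z (g [ z ]≔ x)))
      independent  : ∀ z w → frozen w ≡ false → w ≢ z → ∀ g x → E z (g [ w ]≔ x) ≡ E z g

  open LocallyIndependent

  fixFirstRow : ∀ {n frozen} {E : Fin (suc n) → Vec X (suc n) → Bool} →
    LocallyIndependent frozen E → ∀ x →
    LocallyIndependent (frozen ∘ suc) (λ z g → E (suc z) (x ∷ g))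
  fixFirstRow indep x = record
    { frozen⇒false = λ z fz g → frozen⇒false indep (suc z) fz (x ∷ g)
    ; resample-≥   = λ z fz g → resample-≥ indep (suc z) fz (x ∷ g)
    ; independent  = λ z w fw w≢z g y →
        independent indep (suc z) (suc w) fw (w≢z ∘ Fin.suc-injective) (x ∷ g) y
    }

  successes : ∀ {n} {G : Set} → (Fin n → G → Bool) → G → ℕ
  successes E g = count (λ z → E z g)

  fewSuccesses-≤ : ∀ {n frozen} {E : Fin n → Vec X n → Bool} → LocallyIndependent frozen E →
    ∀ j → ∑ (sumVec SX n) (atMost j ∘ successes E) ≤ R ^ count frozen * lowerTail (count (not ∘ frozen)) j
  fewSuccesses-≤ {zero} indep j = ≤-refl
  fewSuccesses-≤ {suc n} {frozen} {E} indep j with frozen zero in eq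
  ... | true = begin
    ∑ SX (λ x → ∑Vec SX n (λ g → atMost j (indicator (E zero (x ∷ g)) + successes E₊ (x ∷ g))))
      ≡⟨ ∑-cong SX (λ x → ∑-cong (sumVec SX n) (λ g →
           cong (λ e → atMost j (indicator e + successes E₊ (x ∷ g))) (frozen⇒false indep zero eq (x ∷ g)))) ⟩
    ∑ SX (λ x → ∑Vec SX n (λ g → atMost j (successes E₊ (x ∷ g))))
      ≤⟨ ∑-mono-≤ SX (λ x → fewSuccesses-≤ (fixFirstRow indep x) j) ⟩
    ∑ SX (λ _ → K)       ≡⟨ ∑-const SX K ⟩
    R * K                ≡⟨ sym (*-assoc R _ _) ⟩
    R * R ^ count (frozen ∘ suc) * lowerTail (count (not ∘ frozen ∘ suc)) j ∎
    where
    open ≤-Reasoning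
    E₊ : Fin n → Vec X (suc n) → Bool
    E₊ z = E (suc z)
    K = R ^ count (frozen ∘ suc) * lowerTail (count (not ∘ frozen ∘ suc)) j
  ... | false = bound j
    where
    open ≤-Reasoning
    E₊ : Fin n → Vec X (suc n) → Bool
    E₊ z = E (suc z)
    -- By independence the other successes do not see the first row; x₀ is just a reference value.
    rest : Vec X n → ℕ
    rest g = successes E₊ (x₀ ∷ g)
    rest-indep : ∀ x g → successes E₊ (x ∷ g) ≡ rest g
    rest-indep x g = ∑-cong (sumFin n) (λ z →
      cong indicator (independent indep (suc z) zero eq (λ ()) (x₀ ∷ g) x))
    first : Vec X n → X → Bool
    first g x = E zero (x ∷ g)
    P : ℕ
    P = R ^ count (frozen ∘ suc)
    T : ℕ → ℕ
    T = lowerTail (count (not ∘ frozen ∘ suc))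
    rest-≤ : ∀ j → ∑Vec SX n (atMost j ∘ rest) ≤ P * T j
    rest-≤ = fewSuccesses-≤ (fixFirstRow indep x₀)
    resample : ∀ j → ∑ SX (λ x → ∑Vec SX n (λ g → atMost j (indicator (first g x) + successes E₊ (x ∷ g))))
                   ≤ a * ∑Vec SX n (λ g → atMost j (suc (rest g))) + b * ∑Vec SX n (atMost j ∘ rest)
    resample j = ≤-trans (≤-reflexive (∑-cong SX λ x → ∑-cong (sumVec SX n) λ g →
                                          cong (λ c → atMost j (indicator (first g x) + c)) (rest-indep x g)))
                         (∑-atMost-oneMore first rest (λ g → resample-≥ indep zero eq (x₀ ∷ g)) j)
    bound : ∀ j → ∑ SX (λ x → ∑Vec SX n (λ g → atMost j (indicator (first g x) + successes E₊ (x ∷ g))))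
                ≤ P * lowerTail (suc (count (not ∘ frozen ∘ suc))) j
    bound zero = begin
      _ ≤⟨ resample zero ⟩
      a * ∑Vec SX n (λ g → atMost 0 (suc (rest g))) + b * ∑Vec SX n (atMost 0 ∘ rest)
        ≡⟨ cong (λ t → a * t + b * ∑Vec SX n (atMost 0 ∘ rest))
                (trans (∑-cong (sumVec SX n) (atMost-zero ∘ rest)) (∑-0 (sumVec SX n))) ⟩
      a * 0 + b * ∑Vec SX n (atMost 0 ∘ rest)
        ≤⟨ +-monoʳ-≤ (a * 0) (*-monoʳ-≤ b (rest-≤ zero)) ⟩
      a * 0 + b * (P * T 0) ≡⟨ reorder₀ a b P (T 0) ⟩
      P * (b * T 0) ∎
      where
      reorder₀ : ∀ a b P t → a * 0 + b * (P * t) ≡ P * (b * t)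
      reorder₀ = solve-∀
    bound (suc j) = begin
      _ ≤⟨ resample (suc j) ⟩
      a * ∑Vec SX n (λ g → atMost (suc j) (suc (rest g))) + b * ∑Vec SX n (atMost (suc j) ∘ rest)
        ≡⟨ cong (λ t → a * t + b * ∑Vec SX n (atMost (suc j) ∘ rest))
                (∑-cong (sumVec SX n) (atMost-suc j ∘ rest)) ⟩
      a * ∑Vec SX n (atMost j ∘ rest) + b * ∑Vec SX n (atMost (suc j) ∘ rest)
        ≤⟨ +-mono-≤ (*-monoʳ-≤ a (rest-≤ j)) (*-monoʳ-≤ b (rest-≤ (suc j))) ⟩
      a * (P * T j) + b * (P * T (suc j)) ≡⟨ reorder a b P (T j) (T (suc j)) ⟩
      P * (a * T j + b * T (suc j)) ∎
      where
      reorder : ∀ a b P t t′ → a * (P * t) + b * (P * t′) ≡ P * (a * t + b * t′)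
      reorder = solve-∀

  lowerTail-mono : ∀ m j → lowerTail m j ≤ lowerTail m (suc j)
  lowerTail-mono zero    j       = ≤-refl
  lowerTail-mono (suc m) zero    = ≤-trans (*-monoʳ-≤ b (lowerTail-mono m zero)) (m≤n+m _ _)
  lowerTail-mono (suc m) (suc j) = +-mono-≤ (*-monoʳ-≤ a (lowerTail-mono m j)) (*-monoʳ-≤ b (lowerTail-mono m (suc j)))

  lowerTail-suc-≤ : a ≤ R → ∀ m j → lowerTail (suc m) j ≤ R * lowerTail m j
  lowerTail-suc-≤ a≤R m zero    = *-monoˡ-≤ (lowerTail m zero) (m∸n≤m R a)
  lowerTail-suc-≤ a≤R m (suc j) = begin
    a * lowerTail m j + b * lowerTail m (suc j)        ≤⟨ +-monoˡ-≤ _ (*-monoʳ-≤ a (lowerTail-mono m j)) ⟩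
    a * lowerTail m (suc j) + b * lowerTail m (suc j)  ≡⟨ sym (*-distribʳ-+ (lowerTail m (suc j)) a b) ⟩
    (a + b) * lowerTail m (suc j)                      ≡⟨ cong (_* lowerTail m (suc j)) (m+[n∸m]≡n a≤R) ⟩
    R * lowerTail m (suc j)                            ∎
    where open ≤-Reasoning

  lowerTail-+-≤ : a ≤ R → ∀ d m j → lowerTail (d + m) j ≤ R ^ d * lowerTail m j
  lowerTail-+-≤ a≤R zero    m j = ≤-reflexive (sym (+-identityʳ _))
  lowerTail-+-≤ a≤R (suc d) m j = begin
    lowerTail (suc (d + m)) j    ≤⟨ lowerTail-suc-≤ a≤R (d + m) j ⟩
    R * lowerTail (d + m) j      ≤⟨ *-monoʳ-≤ R (lowerTail-+-≤ a≤R d m j) ⟩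
    R * (R ^ d * lowerTail m j)  ≡⟨ sym (*-assoc R _ _) ⟩
    R ^ suc d * lowerTail m j    ∎
    where open ≤-Reasoning

  lowerTail-trade : a ≤ R → ∀ {c m p m′} j → c ≤ p → c + m ≡ p + m′ →
    R ^ c * lowerTail m j ≤ R ^ p * lowerTail m′ j
  lowerTail-trade a≤R {c} {m} {p} {m′} j c≤p c+m≡p+m′ = begin
    R ^ c * lowerTail m j             ≡⟨ cong (λ t → R ^ c * lowerTail t j) m≡d+m′ ⟩
    R ^ c * lowerTail (d + m′) j      ≤⟨ *-monoʳ-≤ (R ^ c) (lowerTail-+-≤ a≤R d m′ j) ⟩
    R ^ c * (R ^ d * lowerTail m′ j)  ≡⟨ sym (*-assoc (R ^ c) _ _) ⟩
    R ^ c * R ^ d * lowerTail m′ j    ≡⟨ cong (_* lowerTail m′ j) (sym (^-distribˡ-+-* R c d)) ⟩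
    R ^ (c + d) * lowerTail m′ j      ≡⟨ cong (λ e → R ^ e * lowerTail m′ j) (m+[n∸m]≡n c≤p) ⟩
    R ^ p * lowerTail m′ j            ∎
    where
    open ≤-Reasoning
    d = p ∸ c
    m≡d+m′ : m ≡ d + m′
    m≡d+m′ = +-cancelˡ-≡ c _ _ (begin-equality
      c + m          ≡⟨ c+m≡p+m′ ⟩
      p + m′         ≡⟨ cong (_+ m′) (sym (m+[n∸m]≡n c≤p)) ⟩
      c + d + m′     ≡⟨ +-assoc c d m′ ⟩
      c + (d + m′)   ∎)

  lowerTail-chernoff : ∀ L .{{_ : NonZero L}} m j → L ^ m * lowerTail m j ≤ L ^ j * (a + L * b) ^ m
  lowerTail-chernoff L zero j = *-monoˡ-≤ 1 (m^n>0 L j)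
  lowerTail-chernoff L (suc m) zero = begin
    L * L ^ m * (b * lowerTail m zero)    ≡⟨ reorder L (L ^ m) b (lowerTail m zero) ⟩
    (L * b) * (L ^ m * lowerTail m zero)  ≤⟨ *-monoʳ-≤ (L * b) (lowerTail-chernoff L m zero) ⟩
    (L * b) * (1 * (a + L * b) ^ m)       ≤⟨ *-monoˡ-≤ (1 * (a + L * b) ^ m) (m≤n+m (L * b) a) ⟩
    (a + L * b) * (1 * (a + L * b) ^ m)   ≡⟨ cong ((a + L * b) *_) (*-identityˡ _) ⟩
    (a + L * b) ^ suc m                   ≡⟨ sym (*-identityˡ _) ⟩
    1 * (a + L * b) ^ suc m               ∎
    where
    open ≤-Reasoning
    reorder : ∀ L P b t → L * P * (b * t) ≡ (L * b) * (P * t)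
    reorder = solve-∀
  lowerTail-chernoff L (suc m) (suc j) = begin
    L * L ^ m * (a * lowerTail m j + b * lowerTail m (suc j))
      ≡⟨ distribute L (L ^ m) a b (lowerTail m j) (lowerTail m (suc j)) ⟩
    (L * a) * (L ^ m * lowerTail m j) + (L * b) * (L ^ m * lowerTail m (suc j))
      ≤⟨ +-mono-≤ (*-monoʳ-≤ (L * a) (lowerTail-chernoff L m j))
                  (*-monoʳ-≤ (L * b) (lowerTail-chernoff L m (suc j))) ⟩
    (L * a) * (L ^ j * E) + (L * b) * (L * L ^ j * E)
      ≡⟨ collect L a b (L ^ j) E ⟩
    L * L ^ j * ((a + L * b) * E) ∎
    where
    open ≤-Reasoning
    E = (a + L * b) ^ m
    distribute : ∀ L P a b t t′ → L * P * (a * t + b * t′) ≡ (L * a) * (P * t) + (L * b) * (P * t′)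
    distribute = solve-∀
    collect : ∀ L a b P E → (L * a) * (P * E) + (L * b) * (L * P * E) ≡ L * P * ((a + L * b) * E)
    collect = solve-∀

Rows : ℕ → Set
Rows n = Vec (Vec Bool n) n

module _ {n : ℕ} where

  bit : Rows n → Fin n → Fin n → Bool
  bit g u v = lookup (lookup g u) v

  before : Fin n → Fin n → Bool
  before u v = does (u Fin.<? v)

  before-irrefl : ∀ u → before u u ≡ false
  before-irrefl u = dec-false (u Fin.<? u) (Fin.<-irrefl refl)

  before-antisym : ∀ u v → u ≢ v → before u v ≡ not (before v u)
  before-antisym u v u≢v with Fin.<-cmp u v
  ... | tri< u<v _ v≮u = trans (dec-true (u Fin.<? v) u<v) (cong not (sym (dec-false (v Fin.<? u) v≮u)))
  ... | tri≈ _ u≡v _   = contradiction u≡v u≢v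
  ... | tri> u≮v _ v<u = trans (dec-false (u Fin.<? v) u≮v) (cong not (sym (dec-true (v Fin.<? u) v<u)))

  arcOf : Rows n → Fin n → Fin n → Bool
  arcOf g u v = (bit g u v xor bit g v u) xor before u v

  tournament : Rows n → Tournament n
  tournament g = record { arc = arcOf g ; irrefl = irrefl ; tourn = antisym }
    where
    irrefl : ∀ u → arcOf g u u ≡ false
    irrefl u = cong₂ _xor_ (xor-same (bit g u u)) (before-irrefl u)
    antisym : ∀ u v → u ≢ v → arcOf g u v ≡ not (arcOf g v u)
    antisym u v u≢v = begin
      (bit g u v xor bit g v u) xor before u v        ≡⟨ cong₂ _xor_ (xor-comm (bit g u v) _) (before-antisym u v u≢v) ⟩
      (bit g v u xor bit g u v) xor not (before v u)  ≡⟨ sym (not-distribʳ-xor (bit g v u xor bit g u v) (before v u)) ⟩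
      not ((bit g v u xor bit g u v) xor before v u)  ∎
      where open ≡-Reasoning

  arcOf-update-other : ∀ g w x s t → s ≢ w → t ≢ w → arcOf (g [ w ]≔ x) s t ≡ arcOf g s t
  arcOf-update-other g w x s t s≢w t≢w
    rewrite lookup∘update′ s≢w g x | lookup∘update′ t≢w g x = refl

  arcOf-update-self : ∀ g z x v → v ≢ z →
    arcOf (g [ z ]≔ x) z v ≡ (lookup x v xor bit g v z) xor before z v
  arcOf-update-self g z x v v≢z rewrite lookup∘update z g x | lookup∘update′ v≢z g x = refl

agrees : Maybe Bool → Bool → Bool
agrees nothing  y = true
agrees (just b) y = does (y Bool.≟ b)

agreeing : ∀ {n} → (Fin n → Maybe Bool) → Vec Bool n → Bool
agreeing κ []      = true
agreeing κ (y ∷ x) = agrees (κ zero) y ∧ agreeing (κ ∘ suc) x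

agreeing-lookup : ∀ {n} (κ : Fin n → Maybe Bool) x → agreeing κ x ≡ true →
  ∀ c → agrees (κ c) (lookup x c) ≡ true
agreeing-lookup κ (y ∷ x) h zero    = Bool.∧-conicalˡ _ _ h
agreeing-lookup κ (y ∷ x) h (suc c) = agreeing-lookup (κ ∘ suc) x (Bool.∧-conicalʳ _ _ h) c

∑-agreeing : ∀ n (κ : Fin n → Maybe Bool) →
  ∑ (sumVec sumBool n) (indicator ∘ agreeing κ) ≡ 2 ^ count (is-nothing ∘ κ)
∑-agreeing zero    κ = refl
∑-agreeing (suc n) κ = begin
  ∑Vec sumBool n (λ x → indicator (agrees (κ zero) true ∧ rest x))
    + ∑Vec sumBool n (λ x → indicator (agrees (κ zero) false ∧ rest x))
    ≡⟨ cong₂ _+_ (factor true) (factor false) ⟩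
  indicator (agrees (κ zero) true) * K + indicator (agrees (κ zero) false) * K
    ≡⟨ choices (κ zero) ⟩
  2 ^ (indicator (is-nothing (κ zero)) + count (is-nothing ∘ κ ∘ suc)) ∎
  where
  open ≡-Reasoning
  rest : Vec Bool n → Bool
  rest = agreeing (κ ∘ suc)
  K : ℕ
  K = 2 ^ count (is-nothing ∘ κ ∘ suc)
  indicator-∧ : ∀ e f → indicator (e ∧ f) ≡ indicator e * indicator f
  indicator-∧ true  f = sym (+-identityʳ (indicator f))
  indicator-∧ false f = refl
  factor : ∀ y → ∑Vec sumBool n (λ x → indicator (agrees (κ zero) y ∧ rest x)) ≡ indicator (agrees (κ zero) y) * K
  factor y = trans (∑-cong (sumVec sumBool n) (λ x → indicator-∧ (agrees (κ zero) y) (rest x)))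
           (trans (∑-*ˡ (sumVec sumBool n) (indicator (agrees (κ zero) y)) (indicator ∘ rest))
                  (cong (indicator (agrees (κ zero) y) *_) (∑-agreeing n (κ ∘ suc))))
  choices : ∀ m → indicator (agrees m true) * K + indicator (agrees m false) * K
                  ≡ 2 ^ (indicator (is-nothing m) + count (is-nothing ∘ κ ∘ suc))
  choices nothing      = cong (_+ (K + 0)) (+-identityʳ K)
  choices (just true)  = trans (+-identityʳ (K + 0)) (+-identityʳ K)
  choices (just false) = +-identityʳ K

indicator-any-≤ : ∀ {p} {P : Fin p → Set} (P? : ∀ i → Dec (P i)) →
  indicator (does (Fin.any? P?)) ≤ ∑Fin p (indicator ∘ does ∘ P?)
indicator-any-≤ P? with Fin.any? P?
... | yes (i , Pi) = ≤-trans (≤-reflexive (cong indicator (sym (dec-true (P? i) Pi))))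
                             (≤-∑ (sumFin _) (indicator ∘ does ∘ P?) i)
... | no _         = z≤n

∑-indicator-≡ : ∀ {n} (d : Fin n) → ∑Fin n (λ c → indicator (does (d Fin.≟ c))) ≡ 1
∑-indicator-≡ {suc n} zero    = cong suc (∑-0 (sumFin n))
∑-indicator-≡ {suc n} (suc d) = ∑-indicator-≡ d

module _ {n p : ℕ} (u : Fin p → Fin n) where

  inImage : Fin n → Bool
  inImage c = does (Fin.any? λ i → u i Fin.≟ c)

  count-inImage-≤ : count inImage ≤ p
  count-inImage-≤ = begin
    ∑Fin n (indicator ∘ inImage)
      ≤⟨ ∑-mono-≤ (sumFin n) (λ c → indicator-any-≤ (λ i → u i Fin.≟ c)) ⟩
    ∑Fin n (λ c → ∑Fin p (λ i → indicator (does (u i Fin.≟ c))))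
      ≡⟨ sym (sumFin-fubini p (sumFin n) _) ⟩
    ∑Fin p (λ i → ∑Fin n (λ c → indicator (does (u i Fin.≟ c))))
      ≡⟨ ∑-cong (sumFin p) (∑-indicator-≡ ∘ u) ⟩
    ∑Fin p (λ _ → 1)
      ≡⟨ ∑-1 (sumFin p) ⟩
    p ∎
    where open ≤-Reasoning

  outsideImage-≥ : n ∸ p ≤ count (not ∘ inImage)
  outsideImage-≥ = begin
    n ∸ p                                     ≤⟨ ∸-monoʳ-≤ n count-inImage-≤ ⟩
    n ∸ count inImage                         ≡⟨ cong (_∸ count inImage) (sym (count+count-not inImage)) ⟩
    count inImage + count (not ∘ inImage) ∸ count inImage ≡⟨ m+n∸m≡n (count inImage) _ ⟩
    count (not ∘ inImage)                     ∎
    where open ≤-Reasoning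

  prescribe : (Fin p → Bool) → Fin n → Maybe Bool
  prescribe t c with Fin.any? (λ i → u i Fin.≟ c)
  ... | yes (i , _) = just (t i)
  ... | no _        = nothing

  prescribe-free : ∀ t c → is-nothing (prescribe t c) ≡ not (inImage c)
  prescribe-free t c with Fin.any? (λ i → u i Fin.≟ c)
  ... | yes _ = refl
  ... | no _  = refl

  prescribe-image : Injective _≡_ _≡_ u → ∀ t i → prescribe t (u i) ≡ just (t i)
  prescribe-image inj t i with Fin.any? (λ j → u j Fin.≟ u i)
  ... | yes (j , uj≡ui) = cong (just ∘ t) (inj uj≡ui)
  ... | no ∄j           = contradiction (i , refl) ∄j

  extensions-≥ : Injective _≡_ _≡_ u → ∀ t →
    2 ^ (n ∸ p) ≤ ∑ (sumVec sumBool n) (λ x → indicator (does (Fin.all? λ i → lookup x (u i) Bool.≟ t i)))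
  extensions-≥ inj t = begin
    2 ^ (n ∸ p)                               ≤⟨ ^-monoʳ-≤ 2 outsideImage-≥ ⟩
    2 ^ count (not ∘ inImage)                 ≡⟨ cong (2 ^_) (∑-cong (sumFin n) (cong indicator ∘ sym ∘ prescribe-free t)) ⟩
    2 ^ count (is-nothing ∘ prescribe t)      ≡⟨ sym (∑-agreeing n (prescribe t)) ⟩
    ∑Vec sumBool n (indicator ∘ agreeing (prescribe t)) ≤⟨ ∑-mono-≤ (sumVec sumBool n) (λ x → indicator-≤ (matches x)) ⟩
    ∑Vec sumBool n (λ x → indicator (does (Fin.all? λ i → lookup x (u i) Bool.≟ t i))) ∎
    where
    open ≤-Reasoning
    matches : ∀ x → agreeing (prescribe t) x ≡ true → does (Fin.all? λ i → lookup x (u i) Bool.≟ t i) ≡ true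
    matches x h = dec-true (Fin.all? _) λ i →
      from-does-true (lookup x (u i) Bool.≟ t i)
        (subst (λ m → agrees m (lookup x (u i)) ≡ true) (prescribe-image inj t i) (agreeing-lookup _ x h (u i)))

xor-cancelʳ : ∀ x c → (x xor c) xor c ≡ x
xor-cancelʳ x c = trans (Bool.xor-assoc x c c) (trans (cong (x xor_) (xor-same c)) (Bool.xor-identityʳ x))

xor-≡-⇔ : ∀ x c a → (x xor c ≡ a) ⇔ (x ≡ a xor c)
xor-≡-⇔ x c a = mk⇔ (λ e → trans (sym (xor-cancelʳ x c)) (cong (_xor c) e))
                   (λ e → trans (cong (_xor c) e) (xor-cancelʳ a c))

module _ {n p : ℕ} (u : Fin p → Fin n) (a : Fin p → Bool) where

  Good : Rows n → Fin n → Set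
  Good g z = (∀ i → z ≢ u i) × FEq (tournament g) u z a

  good? : ∀ g z → Dec (Good g z)
  good? g z = Fin.all? (λ i → ¬? (z Fin.≟ u i)) ×-dec Fin.all? (λ i → arcOf g z (u i) Bool.≟ a i)

  good : Fin n → Rows n → Bool
  good z g = does (good? g z)

  outsideImage : ∀ {z} → inImage u z ≡ false → ∀ i → z ≢ u i
  outsideImage z∉U i z≡ui = from-does-false (Fin.any? _) z∉U (i , sym z≡ui)

  module _ (inj : Injective _≡_ _≡_ u) where
    open LowerTail (sumVec sumBool n) (sumVec-fubini sumBool sumBool-fubini n) (replicate n false) (2 ^ (n ∸ p))

    good-locallyIndependent : LocallyIndependent (inImage u) good
    good-locallyIndependent = record
      { frozen⇒false = frozen⇒false
      ; resample-≥   = resample-≥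
      ; independent  = independent
      }
      where
      frozen⇒false : ∀ z → inImage u z ≡ true → ∀ g → good z g ≡ false
      frozen⇒false z z∈U g with from-does-true (Fin.any? _) z∈U
      ... | i , ui≡z = dec-false (good? g z) (λ (z∉U , _) → z∉U i (sym ui≡z))
      independent : ∀ z w → inImage u w ≡ false → w ≢ z → ∀ g x → good z (g [ w ]≔ x) ≡ good z g
      independent z w w∉U w≢z g x = does-⇔ (mk⇔ (map₂ λ h i → trans (sym (same i)) (h i))
                                                 (map₂ λ h i → trans (same i) (h i)))
                                             (good? (g [ w ]≔ x) z) (good? g z)
        where
        same : ∀ i → arcOf (g [ w ]≔ x) z (u i) ≡ arcOf g z (u i)
        same i = arcOf-update-other g w x z (u i) (w≢z ∘ sym) (outsideImage w∉U i ∘ sym)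
      resample-≥ : ∀ z → inImage u z ≡ false → ∀ g →
        2 ^ (n ∸ p) ≤ ∑ (sumVec sumBool n) (λ x → indicator (good z (g [ z ]≔ x)))
      resample-≥ z z∉U g = ≤-trans (extensions-≥ u inj t) (≤-reflexive (∑-cong (sumVec sumBool n) λ x →
        cong indicator (does-⇔ (matches⇔Good x) (Fin.all? λ i → lookup x (u i) Bool.≟ t i) (good? (g [ z ]≔ x) z))))
        where
        open Equivalence
        t : Fin p → Bool
        t i = (a i xor before z (u i)) xor bit g (u i) z
        arc⇔ : ∀ x i → (arcOf (g [ z ]≔ x) z (u i) ≡ a i) ⇔ (lookup x (u i) ≡ t i)
        arc⇔ x i = subst (λ e → (e ≡ a i) ⇔ (lookup x (u i) ≡ t i))
                         (sym (arcOf-update-self g z x (u i) (outsideImage z∉U i ∘ sym)))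
                         (⇔.trans (xor-≡-⇔ _ (before z (u i)) (a i)) (xor-≡-⇔ _ (bit g (u i) z) _))
        matches⇔Good : ∀ x → (∀ i → lookup x (u i) ≡ t i) ⇔ Good (g [ z ]≔ x) z
        matches⇔Good x = mk⇔ (λ h → outsideImage z∉U , λ i → from (arc⇔ x i) (h i))
                             (λ h i → to (arc⇔ x i) (proj₂ h i))

Good-cong : ∀ {n p} {u u′ : Fin p → Fin n} {a a′ g z} → (∀ i → u i ≡ u′ i) → (∀ i → a i ≡ a′ i) →
  Good u a g z → Good u′ a′ g z
Good-cong {g = g} {z} u≗u′ a≗a′ (z∉U , arcs) = (λ i → subst (z ≢_) (u≗u′ i) (z∉U i))
                                     , (λ i → subst₂ (λ v b → arcOf g z v ≡ b) (u≗u′ i) (a≗a′ i) (arcs i))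

increasing⇒injective : ∀ {k n} {u : Fin k → Fin n} → Increasing u → Injective _≡_ _≡_ u
increasing⇒injective {u = u} inc {i} {j} ui≡uj with Fin.<-cmp i j
... | tri< i<j _ _ = contradiction ui≡uj (Fin.<⇒≢ (inc i j i<j))
... | tri≈ _ i≡j _ = i≡j
... | tri> _ _ j<i = contradiction (sym ui≡uj) (Fin.<⇒≢ (inc j i j<i))

select : ∀ {n} (H : Fin n → Bool) k → k ≤ count H →
  Σ (Fin k → Fin n) λ w → Injective _≡_ _≡_ w × (∀ j → H (w j) ≡ true)
select H zero k≤ = (λ ()) , (λ {i} → ⊥-elim (Fin.¬Fin0 i)) , (λ ())
select {suc n} H (suc k) k≤ with H zero in H0
... | true with select (H ∘ suc) k (s≤s⁻¹ k≤)
...   | w , inj , Hw = w′ , inj′ , Hw′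
  where
  w′ : Fin (suc k) → Fin (suc n)
  w′ zero    = zero
  w′ (suc j) = suc (w j)
  inj′ : Injective _≡_ _≡_ w′
  inj′ {zero}  {zero}  _ = refl
  inj′ {suc i} {suc j} e = cong suc (inj (Fin.suc-injective e))
  Hw′ : ∀ j → H (w′ j) ≡ true
  Hw′ zero    = H0
  Hw′ (suc j) = Hw j
select {suc n} H (suc k) k≤ | false with select (H ∘ suc) (suc k) k≤
...   | w , inj , Hw = suc ∘ w , inj ∘ Fin.suc-injective , Hw

module _ (n p : ℕ) where
  open LowerTail (sumVec sumBool n) (sumVec-fubini sumBool sumBool-fubini n) (replicate n false) (2 ^ (n ∸ p))

  sumRows : Summation (Rows n)
  sumRows = sumVec (sumVec sumBool n) n

  fewGood-≤ : ∀ (u : Fin p → Fin n) a → Injective _≡_ _≡_ u →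
    ∑ sumRows (atMost p ∘ successes (good u a)) ≤ R ^ p * lowerTail (n ∸ p) p
  fewGood-≤ u a inj = ≤-trans (fewSuccesses-≤ (good-locallyIndependent u a inj) p)
    (lowerTail-trade (^-monoʳ-≤ 2 (m∸n≤m n p)) p (count-inImage-≤ u)
      (trans (count+count-not (inImage u)) (sym (m+[n∸m]≡n (Fin.injective⇒≤ inj)))))

  injective? : (v : Vec (Fin n) p) → Dec (Injective _≡_ _≡_ (lookup v))
  injective? v = map′ (λ inj {i} {j} → inj i j) (λ inj i j → inj)
    (Fin.all? λ i → Fin.all? λ j → (lookup v i Fin.≟ lookup v j) →-dec (i Fin.≟ j))

  bad : Vec (Fin n) p → Vec Bool p → Rows n → ℕ
  bad v w g = indicator (does (injective? v)) * atMost p (successes (good (lookup v) (lookup w)) g)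

  ∑-bad-≤ : ∀ v w → ∑ sumRows (bad v w) ≤ R ^ p * lowerTail (n ∸ p) p
  ∑-bad-≤ v w = ≤-trans (≤-reflexive (∑-*ˡ sumRows (indicator (does (injective? v))) few))
                        (bound (injective? v))
    where
    few : Rows n → ℕ
    few = atMost p ∘ successes (good (lookup v) (lookup w))
    bound : (inj? : Dec (Injective _≡_ _≡_ (lookup v))) →
      indicator (does inj?) * ∑ sumRows few ≤ R ^ p * lowerTail (n ∸ p) p
    bound (yes inj) = ≤-trans (≤-reflexive (+-identityʳ _)) (fewGood-≤ (lookup v) (lookup w) inj)
    bound (no _)    = z≤n

  union-bound : ∑ sumRows (λ g → ∑ (sumVec (sumFin n) p) λ v → ∑ (sumVec sumBool p) λ w → bad v w g)
                ≤ n ^ p * (2 ^ p * (R ^ p * lowerTail (n ∸ p) p))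
  union-bound = begin
    ∑ sumRows (λ g → ∑ Vs λ v → ∑ Ws λ w → bad v w g)
      ≡⟨ sym (sumVec-fubini (sumFin n) (sumFin-fubini n) p sumRows _) ⟩
    ∑ Vs (λ v → ∑ sumRows λ g → ∑ Ws λ w → bad v w g)
      ≡⟨ ∑-cong Vs (λ v → sym (sumVec-fubini sumBool sumBool-fubini p sumRows _)) ⟩
    ∑ Vs (λ v → ∑ Ws λ w → ∑ sumRows (bad v w))        ≤⟨ ∑-mono-≤ Vs (λ v → ∑-mono-≤ Ws (∑-bad-≤ v)) ⟩
    ∑ Vs (λ v → ∑ Ws λ w → B)                          ≡⟨ ∑-cong Vs (λ v → ∑-const Ws B) ⟩
    ∑ Vs (λ v → 2 ^ p * B)                             ≡⟨ ∑-const Vs (2 ^ p * B) ⟩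
    n ^ p * (2 ^ p * B)                                ∎
    where
    open ≤-Reasoning
    Vs = sumVec (sumFin n) p
    Ws = sumVec sumBool p
    B = R ^ p * lowerTail (n ∸ p) p

  comprehensiveTournament : n ^ p * (2 ^ p * (R ^ p * lowerTail (n ∸ p) p)) < R ^ n →
    Σ (Tournament n) λ T → Comprehensive T p (suc p)
  comprehensiveTournament lt
    with ∑<∑⇒∃< sumRows _ (λ _ → 1) (≤-<-trans union-bound (<-≤-trans lt (≤-reflexive (sym (∑-1 sumRows)))))
  ... | g , noBad = tournament g , comprehensive
    where
    allGood : ∀ v w → bad v w g ≡ 0
    allGood v w = n<1⇒n≡0 (≤-<-trans
      (≤-trans (≤-∑ (sumVec sumBool p) (λ w → bad v w g) w)
               (≤-∑ (sumVec (sumFin n) p) (λ v → ∑ (sumVec sumBool p) λ w → bad v w g) v))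
      noBad)
    comprehensive : Comprehensive (tournament g) p (suc p)
    comprehensive u inc a = selected
      where
      v = tabulate u
      w = tabulate a
      injective-v : Injective _≡_ _≡_ (lookup v)
      injective-v e = increasing⇒injective inc (trans (sym (lookup∘tabulate u _)) (trans e (lookup∘tabulate u _)))
      few : ℕ
      few = atMost p (successes (good (lookup v) (lookup w)) g)
      few≡0 : few ≡ 0
      few≡0 = trans (sym (+-identityʳ few))
                    (subst (λ e → indicator e * few ≡ 0) (dec-true (injective? v) injective-v) (allGood v w))
      selected : Σ (Fin (suc p) → Fin n) λ z → Injective _≡_ _≡_ z × (∀ j → Good u a g (z j))
      selected = map₂ (map₂ λ Gw j → Good-cong {g = g} (lookup∘tabulate u) (lookup∘tabulate a)
                                         (from-does-true (good? (lookup v) (lookup w) g _) (Gw j)))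
                      (select _ (suc p) (atMost≡0⇒< p _ few≡0))

n<2^n : ∀ n → n < 2 ^ n
n<2^n zero    = s≤s z≤n
n<2^n (suc n) = subst (_< 2 ^ suc n) (+-comm n 1) (+-mono-<-≤ (n<2^n n) (≤-trans (m^n>0 2 n) (m≤m+n (2 ^ n) 0)))

^-distribʳ-* : ∀ x y m → (x * y) ^ m ≡ x ^ m * y ^ m
^-distribʳ-* x y zero    = refl
^-distribʳ-* x y (suc m) = trans (cong ((x * y) *_) (^-distribʳ-* x y m)) (reorder x y (x ^ m) (y ^ m))
  where
  reorder : ∀ x y X Y → x * y * (X * Y) ≡ x * X * (y * Y)
  reorder = solve-∀

bernoulli : ∀ a b h → a ^ h * (a + h * b) ≤ a * (a + b) ^ h
bernoulli a b zero    = ≤-reflexive (base a b)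
  where
  base : ∀ a b → 1 * (a + 0 * b) ≡ a * 1
  base = solve-∀
bernoulli a b (suc h) = begin
  a * a ^ h * (a + (1 + h) * b)               ≡⟨ expand a (a ^ h) h b ⟩
  a * (a ^ h * (a + h * b)) + b * (a * a ^ h) ≤⟨ +-mono-≤ (*-monoʳ-≤ a (bernoulli a b h))
                                                           (*-monoʳ-≤ b (*-monoʳ-≤ a (^-monoˡ-≤ h (m≤m+n a b)))) ⟩
  a * (a * Q) + b * (a * Q)                   ≡⟨ collect a b Q ⟩
  a * ((a + b) * Q)                           ∎
  where
  open ≤-Reasoning
  Q = (a + b) ^ h
  expand : ∀ a P h b → a * P * (a + (1 + h) * b) ≡ a * (P * (a + h * b)) + b * (a * P)
  expand = solve-∀
  collect : ∀ a b Q → a * (a * Q) + b * (a * Q) ≡ a * ((a + b) * Q)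
  collect = solve-∀

-- (1 − 7/(8q))^q ≤ 1/2 for q = 2(h′ + 1), with 8q − 7 written as 9 + 16 h′.
doubling : ∀ h′ → 2 * (9 + 16 * h′) ^ (suc h′ + suc h′) ≤ (9 + 16 * h′ + 7) ^ (suc h′ + suc h′)
doubling h′ = *-cancelˡ-≤ (a * a) (begin
  a * a * (2 * a ^ (h + h))               ≡⟨ cong (λ x → a * a * (2 * x)) (^-distribˡ-+-* a h h) ⟩
  a * a * (2 * (P * P))                   ≡⟨ reorder₁ a P ⟩
  2 * (a * a) * (P * P)                   ≤⟨ *-monoˡ-≤ (P * P) quadratic ⟩
  (a + h * 7) * (a + h * 7) * (P * P)     ≡⟨ reorder₂ (a + h * 7) P ⟩
  (P * (a + h * 7)) * (P * (a + h * 7))   ≤⟨ *-mono-≤ (bernoulli a 7 h) (bernoulli a 7 h) ⟩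
  (a * Q) * (a * Q)                       ≡⟨ reorder₃ a Q ⟩
  a * a * (Q * Q)                         ≡⟨ cong (a * a *_) (sym (^-distribˡ-+-* (a + 7) h h)) ⟩
  a * a * (a + 7) ^ (h + h)               ∎)
  where
  open ≤-Reasoning
  h = suc h′
  a = 9 + 16 * h′
  P = a ^ h
  Q = (a + 7) ^ h
  quadratic : 2 * (a * a) ≤ (a + h * 7) * (a + h * 7)
  quadratic = subst (2 * (a * a) ≤_) (expand h′) (m≤m+n _ (17 * (h′ * h′) + 160 * h′ + 94))
    where
    expand : ∀ h′ → 2 * ((9 + 16 * h′) * (9 + 16 * h′)) + (17 * (h′ * h′) + 160 * h′ + 94)
                  ≡ (9 + 16 * h′ + suc h′ * 7) * (9 + 16 * h′ + suc h′ * 7)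
    expand = solve-∀
  reorder₁ : ∀ a P → a * a * (2 * (P * P)) ≡ 2 * (a * a) * (P * P)
  reorder₁ = solve-∀
  reorder₂ : ∀ x P → x * x * (P * P) ≡ (P * x) * (P * x)
  reorder₂ = solve-∀
  reorder₃ : ∀ a Q → (a * Q) * (a * Q) ≡ a * a * (Q * Q)
  reorder₃ = solve-∀

^-blocks : ∀ {A D} q → 2 * A ^ q ≤ D ^ q → ∀ t → A ^ (t * q) * 2 ^ t ≤ D ^ (t * q)
^-blocks q 2Aᵠ≤Dᵠ zero = ≤-refl
^-blocks {A} {D} q 2Aᵠ≤Dᵠ (suc t) = begin
  A ^ (q + t * q) * (2 * 2 ^ t)          ≡⟨ cong (_* (2 * 2 ^ t)) (^-distribˡ-+-* A q (t * q)) ⟩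
  A ^ q * A ^ (t * q) * (2 * 2 ^ t)      ≡⟨ reorder (A ^ q) (A ^ (t * q)) (2 ^ t) ⟩
  (2 * A ^ q) * (A ^ (t * q) * 2 ^ t)    ≤⟨ *-mono-≤ 2Aᵠ≤Dᵠ (^-blocks q 2Aᵠ≤Dᵠ t) ⟩
  D ^ q * D ^ (t * q)                    ≡⟨ sym (^-distribˡ-+-* D q (t * q)) ⟩
  D ^ (q + t * q)                        ∎
  where
  open ≤-Reasoning
  reorder : ∀ x y z → x * y * (2 * z) ≡ (2 * x) * (y * z)
  reorder = solve-∀

^-*-2^/-≤ : ∀ {A D} q .{{_ : NonZero q}} → A ≤ D → 2 * A ^ q ≤ D ^ q → ∀ m → A ^ m * 2 ^ (m / q) ≤ D ^ m
^-*-2^/-≤ {A} {D} q A≤D 2Aᵠ≤Dᵠ m = begin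
  A ^ m * 2 ^ t                    ≡⟨ cong (λ x → A ^ x * 2 ^ t) m≡ ⟩
  A ^ (r + t * q) * 2 ^ t          ≡⟨ cong (_* 2 ^ t) (^-distribˡ-+-* A r (t * q)) ⟩
  A ^ r * A ^ (t * q) * 2 ^ t      ≡⟨ *-assoc (A ^ r) _ _ ⟩
  A ^ r * (A ^ (t * q) * 2 ^ t)    ≤⟨ *-mono-≤ (^-monoˡ-≤ r A≤D) (^-blocks q 2Aᵠ≤Dᵠ t) ⟩
  D ^ r * D ^ (t * q)              ≡⟨ sym (^-distribˡ-+-* D r (t * q)) ⟩
  D ^ (r + t * q)                  ≡⟨ cong (D ^_) (sym m≡) ⟩
  D ^ m                            ∎
  where
  open ≤-Reasoning
  t = m / q
  r = m % q
  m≡ : m ≡ r + t * q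
  m≡ = m≡m%n+[m/n]*n m q

80*square≤2^ : ∀ u → 20 ≤ u → 80 * (suc u * suc u) ≤ 2 ^ u
80*square≤2^ u 20≤u =
  subst (λ x → 80 * (suc x * suc x) ≤ 2 ^ x) {x = u ∸ 20 + 20} {y = u} (m∸n+n≡m 20≤u) (shifted (u ∸ 20))
  where
  shifted : ∀ d → 80 * (suc (d + 20) * suc (d + 20)) ≤ 2 ^ (d + 20)
  shifted zero    = from-yes (35280 ≤? 1048576)
  shifted (suc d) = begin
    80 * (suc (suc v) * suc (suc v))  ≤⟨ *-monoʳ-≤ 80 (subst (suc (suc v) * suc (suc v) ≤_) (grow d) (m≤m+n _ _)) ⟩
    80 * (2 * (suc v * suc v))        ≡⟨ *-comm-2 (suc v * suc v) ⟩
    2 * (80 * (suc v * suc v))        ≤⟨ *-monoʳ-≤ 2 (shifted d) ⟩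
    2 * 2 ^ v                         ∎
    where
    open ≤-Reasoning
    v = d + 20
    *-comm-2 : ∀ x → 80 * (2 * x) ≡ 2 * (80 * x)
    *-comm-2 = solve-∀
    grow : ∀ d → suc (suc (d + 20)) * suc (suc (d + 20)) + (d * d + 40 * d + 398)
               ≡ 2 * (suc (d + 20) * suc (d + 20))
    grow = solve-∀

[10*s]^k<2^s : ∀ k s → 200 ≤ k → k * k ≤ 8 * s → (10 * s) ^ k < 2 ^ s
[10*s]^k<2^s k@(suc _) s 200≤k k²≤8s = begin-strict
  (10 * s) ^ k                 <⟨ ^-monoˡ-< k 10s< ⟩
  (80 * (suc u * suc u)) ^ k   ≤⟨ ^-monoˡ-≤ k (80*square≤2^ u 20≤u) ⟩
  (2 ^ u) ^ k                  ≡⟨ ^-*-assoc 2 u k ⟩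
  2 ^ (u * k)                  ≤⟨ ^-monoʳ-≤ 2 (subst (u * k ≤_) (sym s≡) (m≤n+m (u * k) (s % k))) ⟩
  2 ^ s                        ∎
  where
  open ≤-Reasoning
  u = s / k
  s≡ : s ≡ s % k + u * k
  s≡ = m≡m%n+[m/n]*n s k
  s< : s < suc u * k
  s< = subst (_< suc u * k) (sym s≡) (+-monoˡ-< (u * k) (m%n<n s k))
  k< : k < 8 * suc u
  k< = *-cancelʳ-< k k (8 * suc u) (begin-strict
    k * k               ≤⟨ k²≤8s ⟩
    8 * s               <⟨ *-monoʳ-< 8 s< ⟩
    8 * (suc u * k)     ≡⟨ sym (*-assoc 8 (suc u) k) ⟩
    8 * suc u * k       ∎)
  20≤u : 20 ≤ u
  20≤u with 20 ≤? u
  ... | yes 20≤u = 20≤u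
  ... | no 20≰u  = contradiction (from-yes (160 <? 201))
                                 (≤⇒≯ (≤-trans (≤-trans (s≤s 200≤k) k<) (*-monoʳ-≤ 8 (≰⇒> 20≰u))))
  10s< : 10 * s < 80 * (suc u * suc u)
  10s< = begin-strict
    10 * s                       <⟨ *-monoʳ-< 10 s< ⟩
    10 * (suc u * k)             ≤⟨ *-monoʳ-≤ 10 (*-monoʳ-≤ (suc u) (<⇒≤ k<)) ⟩
    10 * (suc u * (8 * suc u))   ≡⟨ reorder (suc u) ⟩
    80 * (suc u * suc u)         ∎
    where
    reorder : ∀ x → 10 * (x * (8 * x)) ≡ 80 * (x * x)
    reorder = solve-∀

exponent-slack : ∀ k t → 200 ≤ k → 6 * (k * k) < 5 * (t + 2) →
  ∃ λ s → k * k + 4 * k + s ≡ t × k * k ≤ 8 * s × t + 2 ≤ 10 * s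
exponent-slack k t 200≤k 6K<5[t+2] = s , E+s≡t , K≤8s , t+2≤10s
  where
  open ≤-Reasoning
  K = k * k
  E = K + 4 * k
  small : ∀ c → c ≤ 200 → c ≤ k
  small c c≤200 = ≤-trans c≤200 200≤k
  linear : ∀ c → c ≤ 200 → c * k ≤ K
  linear c c≤200 = *-monoˡ-≤ k (small c c≤200)
  5E+10≤6K : 5 * E + 10 ≤ 6 * K
  5E+10≤6K = begin
    5 * E + 10             ≡⟨ expand K k ⟩
    5 * K + (20 * k + 10)  ≤⟨ +-monoʳ-≤ (5 * K) (+-monoʳ-≤ (20 * k) (small 10 (from-yes (10 ≤? 200)))) ⟩
    5 * K + (20 * k + k)   ≡⟨ cong (5 * K +_) (+-comm (20 * k) k) ⟩
    5 * K + 21 * k         ≤⟨ +-monoʳ-≤ (5 * K) (linear 21 (from-yes (21 ≤? 200))) ⟩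
    5 * K + K              ≡⟨ +-comm (5 * K) K ⟩
    6 * K                  ∎
    where
    expand : ∀ K k → 5 * (K + 4 * k) + 10 ≡ 5 * K + (20 * k + 10)
    expand = solve-∀
  E<t : E < t
  E<t = *-cancelˡ-< 5 E t (+-cancelʳ-< 10 (5 * E) (5 * t)
          (≤-<-trans 5E+10≤6K (subst (6 * K <_) (*-distribˡ-+ 5 t 2) 6K<5[t+2])))
  s = t ∸ E
  E+s≡t : E + s ≡ t
  E+s≡t = m+[n∸m]≡n (<⇒≤ E<t)
  160k+80≤3K : 160 * k + 80 ≤ 3 * K
  160k+80≤3K = begin
    160 * k + 80  ≤⟨ +-monoʳ-≤ (160 * k) (small 80 (from-yes (80 ≤? 200))) ⟩
    160 * k + k   ≡⟨ +-comm (160 * k) k ⟩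
    161 * k       ≤⟨ linear 161 (from-yes (161 ≤? 200)) ⟩
    K             ≤⟨ m≤m*n K 3 ⟩
    K * 3         ≡⟨ *-comm K 3 ⟩
    3 * K         ∎
  K≤8s : K ≤ 8 * s
  K≤8s = <⇒≤ (*-cancelˡ-< 5 K (8 * s) (subst (5 * K <_) (*-assoc 5 8 s)
           (+-cancelˡ-< (40 * K + 160 * k + 80) (5 * K) (40 * s) (begin-strict
             40 * K + 160 * k + 80 + 5 * K      ≡⟨ reassoc K k ⟩
             40 * K + (160 * k + 80) + 5 * K    ≤⟨ +-monoˡ-≤ (5 * K) (+-monoʳ-≤ (40 * K) 160k+80≤3K) ⟩
             40 * K + 3 * K + 5 * K             ≡⟨ collect K ⟩
             8 * (6 * K)                        <⟨ *-monoʳ-< 8 6K<5[t+2] ⟩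
             8 * (5 * (t + 2))                  ≡⟨ cong (λ x → 8 * (5 * (x + 2))) (sym E+s≡t) ⟩
             8 * (5 * (E + s + 2))              ≡⟨ expand K k s ⟩
             40 * K + 160 * k + 80 + 40 * s     ∎))))
    where
    reassoc : ∀ K k → 40 * K + 160 * k + 80 + 5 * K ≡ 40 * K + (160 * k + 80) + 5 * K
    reassoc = solve-∀
    collect : ∀ K → 40 * K + 3 * K + 5 * K ≡ 8 * (6 * K)
    collect = solve-∀
    expand : ∀ K k s → 8 * (5 * (K + 4 * k + s + 2)) ≡ 40 * K + 160 * k + 80 + 40 * s
    expand = solve-∀
  4k+2≤s : 4 * k + 2 ≤ s
  4k+2≤s = *-cancelˡ-≤ 8 (begin
    8 * (4 * k + 2)  ≡⟨ expand k ⟩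
    32 * k + 16      ≤⟨ +-monoʳ-≤ (32 * k) (small 16 (from-yes (16 ≤? 200))) ⟩
    32 * k + k       ≡⟨ +-comm (32 * k) k ⟩
    33 * k           ≤⟨ linear 33 (from-yes (33 ≤? 200)) ⟩
    K                ≤⟨ K≤8s ⟩
    8 * s            ∎)
    where
    expand : ∀ k → 8 * (4 * k + 2) ≡ 32 * k + 16
    expand = solve-∀
  t+2≤10s : t + 2 ≤ 10 * s
  t+2≤10s = begin
    t + 2                  ≡⟨ cong (_+ 2) (sym E+s≡t) ⟩
    K + 4 * k + s + 2      ≡⟨ reassoc K k s ⟩
    K + (4 * k + 2) + s    ≤⟨ +-monoˡ-≤ s (+-mono-≤ K≤8s 4k+2≤s) ⟩
    8 * s + s + s          ≡⟨ collect s ⟩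
    10 * s                 ∎
    where
    reassoc : ∀ K k s → K + 4 * k + s + 2 ≡ K + (4 * k + 2) + s
    reassoc = solve-∀
    collect : ∀ s → 8 * s + s + s ≡ 10 * s
    collect = solve-∀

poly*2^-<-2^ : ∀ k t → 200 ≤ k → 6 * (k * k) < 5 * (t + 2) → (t + 2) ^ k * 2 ^ (k * k + 4 * k) < 2 ^ t
poly*2^-<-2^ k t 200≤k 6K<5[t+2] = begin-strict
  (t + 2) ^ k * 2 ^ E     ≤⟨ *-monoˡ-≤ (2 ^ E) (^-monoˡ-≤ k t+2≤10s) ⟩
  (10 * s) ^ k * 2 ^ E    <⟨ *-monoˡ-< (2 ^ E) {{m^n≢0 2 E}} ([10*s]^k<2^s k s 200≤k K≤8s) ⟩
  2 ^ s * 2 ^ E           ≡⟨ sym (^-distribˡ-+-* 2 s E) ⟩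
  2 ^ (s + E)             ≡⟨ cong (2 ^_) (trans (+-comm s E) E+s≡t) ⟩
  2 ^ t                   ∎
  where
  open ≤-Reasoning
  E = k * k + 4 * k
  slack = exponent-slack k t 200≤k 6K<5[t+2]
  s = proj₁ slack
  E+s≡t = proj₁ (proj₂ slack)
  K≤8s = proj₁ (proj₂ (proj₂ slack))
  t+2≤10s = proj₂ (proj₂ (proj₂ slack))

-- Chernoff with weight 8: a + 8b = (8q − 7) a where a = 2^(n−p) and q = 2^p, so it remains to
-- show n^p 16^p (8q − 7)^m < (8q)^m, which follows from doubling and poly*2^-<-2^.
module FewBadConfigurations (n p₁ : ℕ) (200≤k : 200 ≤ suc (suc p₁))
                            (3M≤5n : 3 * (suc (suc p₁) * suc (suc p₁) * 2 ^ suc (suc p₁)) ≤ 5 * n) where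

  p k m q : ℕ
  p = suc p₁
  k = suc p
  m = n ∸ p
  q = 2 ^ p

  instance
    q-nonZero : NonZero q
    q-nonZero = m^n≢0 2 p

  t h′ A : ℕ
  t = m / q
  h′ = 2 ^ p₁ ∸ 1
  A = 9 + 16 * h′

  open LowerTail (sumVec sumBool n) (sumVec-fubini sumBool sumBool-fubini n) (replicate n false) (2 ^ m)

  q≡ : q ≡ suc h′ + suc h′
  q≡ = trans (cong (λ x → x + (x + 0)) (sym (m+[n∸m]≡n (m^n>0 2 p₁))))
             (cong (suc h′ +_) (+-identityʳ (suc h′)))

  A+7≡8q : A + 7 ≡ 8 * q
  A+7≡8q = trans (expand h′) (cong (8 *_) (sym q≡))
    where
    expand : ∀ h′ → 9 + 16 * h′ + 7 ≡ 8 * (suc h′ + suc h′)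
    expand = solve-∀

  p≤n : p ≤ n
  p≤n = *-cancelˡ-≤ 5 (begin
    5 * p               ≤⟨ *-monoʳ-≤ 5 (n≤1+n p) ⟩
    5 * k               ≤⟨ *-monoˡ-≤ k (≤-trans (from-yes (5 ≤? 200)) 200≤k) ⟩
    k * k               ≤⟨ m≤m*n (k * k) (2 ^ k) {{m^n≢0 2 k}} ⟩
    k * k * 2 ^ k       ≤⟨ m≤n*m (k * k * 2 ^ k) 3 ⟩
    3 * (k * k * 2 ^ k) ≤⟨ 3M≤5n ⟩
    5 * n               ∎)
    where open ≤-Reasoning

  n≡p+m : n ≡ p + m
  n≡p+m = sym (m+[n∸m]≡n p≤n)

  n<[t+2]q : n < (t + 2) * q
  n<[t+2]q = begin-strict
    n                   ≡⟨ trans n≡p+m (cong (p +_) (m≡m%n+[m/n]*n m q)) ⟩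
    p + (m % q + t * q) <⟨ +-mono-<-≤ (n<2^n p) (+-monoˡ-≤ (t * q) (<⇒≤ (m%n<n m q))) ⟩
    q + (q + t * q)     ≡⟨ collect q t ⟩
    (t + 2) * q         ∎
    where
    open ≤-Reasoning
    collect : ∀ q t → q + (q + t * q) ≡ (t + 2) * q
    collect = solve-∀

  6k²<5[t+2] : 6 * (k * k) < 5 * (t + 2)
  6k²<5[t+2] = *-cancelʳ-< q (6 * (k * k)) (5 * (t + 2)) (begin-strict
    6 * (k * k) * q           ≡⟨ reorder (k * k) q ⟩
    3 * (k * k * (2 * q))     ≤⟨ 3M≤5n ⟩
    5 * n                     <⟨ *-monoʳ-< 5 n<[t+2]q ⟩
    5 * ((t + 2) * q)         ≡⟨ sym (*-assoc 5 (t + 2) q) ⟩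
    5 * (t + 2) * q           ∎)
    where
    open ≤-Reasoning
    reorder : ∀ K q → 6 * K * q ≡ 3 * (K * (2 * q))
    reorder = solve-∀

  n^p*16^p≤ : n ^ p * (2 ^ p * 8 ^ p) ≤ (t + 2) ^ k * 2 ^ (k * k + 4 * k)
  n^p*16^p≤ = begin
    n ^ p * (2 ^ p * 8 ^ p)                   ≤⟨ *-monoˡ-≤ _ (^-monoˡ-≤ p (<⇒≤ n<[t+2]q)) ⟩
    ((t + 2) * q) ^ p * (2 ^ p * 8 ^ p)       ≡⟨ cong₂ _*_ (^-distribʳ-* (t + 2) q p) 2^p*8^p≡ ⟩
    (t + 2) ^ p * q ^ p * 2 ^ (p + 3 * p)     ≡⟨ cong (λ x → (t + 2) ^ p * x * 2 ^ (p + 3 * p)) (^-*-assoc 2 p p) ⟩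
    (t + 2) ^ p * 2 ^ (p * p) * 2 ^ (p + 3 * p)   ≡⟨ *-assoc ((t + 2) ^ p) _ _ ⟩
    (t + 2) ^ p * (2 ^ (p * p) * 2 ^ (p + 3 * p)) ≡⟨ cong ((t + 2) ^ p *_) (sym (^-distribˡ-+-* 2 (p * p) (p + 3 * p))) ⟩
    (t + 2) ^ p * 2 ^ (p * p + (p + 3 * p))   ≤⟨ *-mono-≤ (^-monoʳ-≤ (t + 2) (n≤1+n p)) (^-monoʳ-≤ 2 exponent≤) ⟩
    (t + 2) ^ k * 2 ^ (k * k + 4 * k)         ∎
    where
    open ≤-Reasoning
    instance
      t+2-nonZero : NonZero (t + 2)
      t+2-nonZero = >-nonZero (≤-trans (s≤s z≤n) (m≤n+m 2 t))
    2^p*8^p≡ : 2 ^ p * 8 ^ p ≡ 2 ^ (p + 3 * p)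
    2^p*8^p≡ = trans (cong (2 ^ p *_) (^-*-assoc 2 3 p)) (sym (^-distribˡ-+-* 2 p (3 * p)))
    expand : ∀ p → suc p * suc p + 4 * suc p ≡ p * p + (p + 3 * p) + (2 * p + 5)
    expand = solve-∀
    exponent≤ : p * p + (p + 3 * p) ≤ k * k + 4 * k
    exponent≤ = subst (p * p + (p + 3 * p) ≤_) (sym (expand p)) (m≤m+n _ _)

  Aᵐ*2ᵗ≤[8q]ᵐ : A ^ m * 2 ^ t ≤ (A + 7) ^ m
  Aᵐ*2ᵗ≤[8q]ᵐ = ^-*-2^/-≤ q (m≤m+n A 7) (subst (λ e → 2 * A ^ e ≤ (A + 7) ^ e) (sym q≡) (doubling h′)) m

  n^p*16^p*Aᵐ<[8q]ᵐ : n ^ p * (2 ^ p * 8 ^ p) * A ^ m < (A + 7) ^ m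
  n^p*16^p*Aᵐ<[8q]ᵐ = begin-strict
    n ^ p * (2 ^ p * 8 ^ p) * A ^ m   <⟨ *-monoˡ-< (A ^ m) {{m^n≢0 A m}}
                                           (≤-<-trans n^p*16^p≤ (poly*2^-<-2^ k t 200≤k 6k²<5[t+2])) ⟩
    2 ^ t * A ^ m                     ≡⟨ *-comm (2 ^ t) (A ^ m) ⟩
    A ^ m * 2 ^ t                     ≤⟨ Aᵐ*2ᵗ≤[8q]ᵐ ⟩
    (A + 7) ^ m                       ∎
    where open ≤-Reasoning

  R≡q*a : R ≡ q * 2 ^ m
  R≡q*a = trans (cong (2 ^_) n≡p+m) (^-distribˡ-+-* 2 p m)

  a+8b≡A*a : 2 ^ m + 8 * b ≡ A * 2 ^ m
  a+8b≡A*a = begin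
    2 ^ m + 8 * (R ∸ 2 ^ m)                    ≡⟨ cong (λ r → 2 ^ m + 8 * (r ∸ 2 ^ m)) (trans R≡q*a (cong (_* 2 ^ m) q≡)) ⟩
    2 ^ m + 8 * ((suc h′ + suc h′) * 2 ^ m ∸ 2 ^ m) ≡⟨ cong (λ x → 2 ^ m + 8 * (x ∸ 2 ^ m)) (split h′ (2 ^ m)) ⟩
    2 ^ m + 8 * (2 ^ m + (1 + 2 * h′) * 2 ^ m ∸ 2 ^ m) ≡⟨ cong (λ x → 2 ^ m + 8 * x) (m+n∸m≡n (2 ^ m) _) ⟩
    2 ^ m + 8 * ((1 + 2 * h′) * 2 ^ m)       ≡⟨ collect h′ (2 ^ m) ⟩
    A * 2 ^ m                                ∎
    where
    open ≡-Reasoning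
    split : ∀ h′ x → (suc h′ + suc h′) * x ≡ x + (1 + 2 * h′) * x
    split = solve-∀
    collect : ∀ h′ x → x + 8 * ((1 + 2 * h′) * x) ≡ (9 + 16 * h′) * x
    collect = solve-∀

  [A+7]*a≡8R : (A + 7) * 2 ^ m ≡ 8 * R
  [A+7]*a≡8R = trans (cong (_* 2 ^ m) A+7≡8q) (trans (*-assoc 8 q (2 ^ m)) (cong (8 *_) (sym R≡q*a)))

  8ᵐ*bad<8ᵐ*Rᵐ : 8 ^ m * (n ^ p * (2 ^ p * lowerTail m p)) < 8 ^ m * R ^ m
  8ᵐ*bad<8ᵐ*Rᵐ = begin-strict
    8 ^ m * (n ^ p * (2 ^ p * lowerTail m p))           ≡⟨ reorder₁ (8 ^ m) (n ^ p) (2 ^ p) (lowerTail m p) ⟩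
    n ^ p * 2 ^ p * (8 ^ m * lowerTail m p)             ≤⟨ *-monoʳ-≤ (n ^ p * 2 ^ p) (lowerTail-chernoff 8 m p) ⟩
    n ^ p * 2 ^ p * (8 ^ p * (2 ^ m + 8 * b) ^ m)  ≡⟨ cong (λ x → n ^ p * 2 ^ p * (8 ^ p * x ^ m)) a+8b≡A*a ⟩
    n ^ p * 2 ^ p * (8 ^ p * (A * 2 ^ m) ^ m)      ≡⟨ cong (λ x → n ^ p * 2 ^ p * (8 ^ p * x)) (^-distribʳ-* A (2 ^ m) m) ⟩
    n ^ p * 2 ^ p * (8 ^ p * (A ^ m * aᵐ))         ≡⟨ reorder₂ (n ^ p) (2 ^ p) (8 ^ p) (A ^ m) aᵐ ⟩
    n ^ p * (2 ^ p * 8 ^ p) * A ^ m * aᵐ           <⟨ *-monoˡ-< aᵐ {{m^n≢0 (2 ^ m) m {{m^n≢0 2 m}}}} n^p*16^p*Aᵐ<[8q]ᵐ ⟩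
    (A + 7) ^ m * aᵐ                               ≡⟨ sym (^-distribʳ-* (A + 7) (2 ^ m) m) ⟩
    ((A + 7) * 2 ^ m) ^ m                          ≡⟨ cong (_^ m) [A+7]*a≡8R ⟩
    (8 * R) ^ m                                    ≡⟨ ^-distribʳ-* 8 R m ⟩
    8 ^ m * R ^ m                                  ∎
    where
    open ≤-Reasoning
    aᵐ = (2 ^ m) ^ m
    reorder₁ : ∀ E N P T → E * (N * (P * T)) ≡ N * P * (E * T)
    reorder₁ = solve-∀
    reorder₂ : ∀ N P E A B → N * P * (E * (A * B)) ≡ N * (P * E) * A * B
    reorder₂ = solve-∀

  fewBad : n ^ p * (2 ^ p * (R ^ p * lowerTail m p)) < R ^ n
  fewBad = begin-strict
    n ^ p * (2 ^ p * (R ^ p * lowerTail m p))  ≡⟨ reorder (n ^ p) (2 ^ p) (R ^ p) (lowerTail m p) ⟩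
    R ^ p * (n ^ p * (2 ^ p * lowerTail m p))  <⟨ *-monoʳ-< (R ^ p) {{m^n≢0 R p {{m^n≢0 2 n}}}}
                                               (*-cancelˡ-< (8 ^ m) _ _ 8ᵐ*bad<8ᵐ*Rᵐ) ⟩
    R ^ p * R ^ m                         ≡⟨ sym (^-distribˡ-+-* R p m) ⟩
    R ^ (p + m)                           ≡⟨ cong (R ^_) (sym n≡p+m) ⟩
    R ^ n                                 ∎
    where
    open ≤-Reasoning
    reorder : ∀ N P Q T → N * (P * (Q * T)) ≡ Q * (N * (P * T))
    reorder = solve-∀

lemma4 : (ε : ℝ) → Positive ε →
    ∃ λ (N : ℕ) → ∀ (k : ℕ) → N ≤ k →
    ∀ (n : ℕ) → IsCeilMulLn2ε ε (k * k * 2 ^ k) n →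
    Σ (Tournament n) λ T → Comprehensive T (k ∸ 1) k
lemma4 ε ε>0 = 200 , construct
  where
  construct : ∀ k → 200 ≤ k → ∀ n → IsCeilMulLn2ε ε (k * k * 2 ^ k) n →
    Σ (Tournament n) λ T → Comprehensive T (k ∸ 1) k
  construct (suc zero) (s≤s ()) n _
  construct k@(suc (suc p₁)) 200≤k n (_ , ceiling) =
    comprehensiveTournament n (suc p₁)
      (FewBadConfigurations.fewBad n p₁ 200≤k (CeilingBound.ceiling⇒3M≤5n ε ε>0 (k * k * 2 ^ k) n ceiling))
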